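{- There is no bicrucial permutation with respect to squares of length $11$, while bicrucial permutations with respect to squares of length $19$ and of length $27$ exist.
   Context: Permutations are written in one-line notation. A factor is a sequence of consecutive entries; two sequences of distinct numbers of equal length are order-isomorphic if their entries are in the same relative order. A square is a factor $XY$ with $X,Y$ consecutive, of equal length at least $2$, and order-isomorphic. A permutation is square-free if it contains no square. For $\pi=\pi_1\cdots\pi_n$, $x\in\{1,\dots,n+1\}$ and $i\in\{0,\dots,n\}$, the extension of $\pi$ by $x$ in position $i$ is $\pi'_1\cdots\pi'_i\,x\,\pi'_{i+1}\cdots\pi'_n$, where $\pi'_j=\pi_j$ if $\pi_j<x$ and $\pi'_j=\pi_j+1$ otherwise; $i=0$ gives an extension to the left and $i=n$ an extension to the right. A permutation is bicrucial with respect to squares if it is square-free but every extension of it to the left and every extension of it to the right (by any element) contains a square. -}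

module Defs where

open import Data.Nat using (ℕ; zero; suc; _+_; _*_; _≤_; _<_; _<ᵇ_)
open import Data.Bool using (if_then_else_)
open import Data.List using (List; []; _∷_; _++_; map; take; drop; length; lookup; upTo)
open import Data.List.Relation.Binary.Permutation.Propositional using (_↭_)
open import Data.Fin using (Fin; cast)
open import Data.Product using (Σ; ∃; _×_; _,_)
open import Function.Bundles using (_⇔_)
open import Relation.Nullary using (¬_)
open import Relation.Binary.PropositionalEquality using (_≡_)

IsPerm : ℕ → List ℕ → Set
IsPerm n π = π ↭ map suc (upTo n)

OrderIso : List ℕ → List ℕ → Set
OrderIso xs ys =
  Σ (length xs ≡ length ys) λ e →
    ∀ (i j : Fin (length xs)) →
      (lookup xs i < lookup xs j) ⇔ (lookup ys (cast e i) < lookup ys (cast e j))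

-- The factor of length k starting at (0-based) position i.
factor : List ℕ → ℕ → ℕ → List ℕ
factor π i k = take k (drop i π)

ContainsSquare : List ℕ → Set
ContainsSquare π =
  ∃ λ i → ∃ λ k → 2 ≤ k × i + 2 * k ≤ length π ×
    OrderIso (factor π i k) (factor π (i + k) k)

SquareFree : List ℕ → Set
SquareFree π = ¬ ContainsSquare π

bump : ℕ → ℕ → ℕ
bump x y = if y <ᵇ x then y else suc y

extend : List ℕ → ℕ → ℕ → List ℕ
extend π x i = map (bump x) (take i π) ++ x ∷ map (bump x) (drop i π)

Bicrucial : List ℕ → Set
Bicrucial π =
  SquareFree π ×
  (∀ x → 1 ≤ x → x ≤ suc (length π) → ContainsSquare (extend π x 0)) ×
  (∀ x → 1 ≤ x → x ≤ suc (length π) → ContainsSquare (extend π x (length π)))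

BicrucialPermOfLength : ℕ → Set
BicrucialPermOfLength n = Σ (List ℕ) λ π → IsPerm n π × Bicrucial π

-- Both parts are finite computations, carried out by evaluating Boolean checks whose soundness is
-- proved. A square in a suffix of a permutation is a square of the permutation, so the permutations
-- of length 11 can be built from right to left, discarding a partial suffix as soon as a square
-- appears at its left end. Every square-free permutation π reached this way has a value x whose
-- left or right extension has no square through the new entry; since bump x preserves order, any
-- other square of that extension would be a square of π, so the extension is square-free and π is
-- not bicrucial. The permutations of lengths 19 and 27 are checked directly.
module Submission where

open import Defs
open import Data.Bool.Base using (Bool; true; false; not; _∧_; _∨_; T)
open import Data.Bool.Properties using (T-∧; T-∨)
open import Data.Bool.ListAction using (all)
open import Data.Fin.Base using (cast) renaming (zero to fzero; suc to fsuc)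
open import Data.List.Base
  using (List; []; _∷_; _++_; _∷ʳ_; [_]; map; take; drop; length; lookup; upTo; initLast; _∷ʳ′_)
open import Data.List.Properties
  using (∷ʳ-++; take-map; drop-map; take-all; drop-all; length-map; length-++; ++-identityʳ)
open import Data.List.Membership.Propositional.Properties using (∈-upTo⁺; ∈-∃++; ∈-++⁺ʳ)
open import Data.List.Relation.Unary.All as All using ()
open import Data.List.Relation.Unary.All.Properties using (all⁺)
open import Data.List.Relation.Unary.Any using (here)
open import Data.List.Relation.Binary.Permutation.Propositional using (_↭_; ↭-sym)
open import Data.List.Relation.Binary.Permutation.Propositional.Properties using (↭-empty-inv; ¬x∷xs↭[]; ∈-resp-↭; drop-mid)
open import Data.Nat.Base using (ℕ; zero; suc; _+_; _*_; _∸_; _<ᵇ_; _≤ᵇ_; _≤_; _<_; _≮_; z≤n; s≤s; s≤s⁻¹; z<s; s<s)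
open import Data.Nat.Properties
open import Data.List.Sort.InsertionSort.Base ≤-decTotalOrder using (sort)
open import Data.List.Sort.InsertionSort.Properties ≤-decTotalOrder using (sort-↭)
open import Data.Product.Base using (∃; ∃₂; _×_; _,_; proj₁; proj₂)
open import Data.Sum.Base using (_⊎_; inj₁; inj₂)
open import Function.Base using (_∘_; const)
open import Function.Bundles using (_⇔_; mk⇔; Equivalence)
open import Relation.Binary.Core using (_Preserves_⟶_)
open import Relation.Binary.PropositionalEquality using (_≡_; refl; sym; trans; cong; cong₂; subst; subst₂)
open import Relation.Nullary.Decidable using (yes; no)
open import Relation.Nullary.Negation using (¬_; contradiction)
open import Relation.Nullary.Reflects using (Reflects; ofʸ; ofⁿ; of; det; fromEquivalence; _×-reflects_)

open Equivalence using (to; from)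

T⇔ : ∀ {A : Set} {b} → Reflects A b → T b ⇔ A
T⇔ (ofʸ a)  = mk⇔ (const a) (const _)
T⇔ (ofⁿ ¬a) = mk⇔ (λ ()) ¬a

T-not : ∀ {b} → T (not b) → ¬ T b
T-not {false} _ ()

infix 4 _⇔ᵇ_
_⇔ᵇ_ : Bool → Bool → Bool
true  ⇔ᵇ b = b
false ⇔ᵇ b = not b

_⇔-reflects_ : ∀ {A B : Set} {a b} → Reflects A a → Reflects B b → Reflects (A ⇔ B) (a ⇔ᵇ b)
ofʸ a  ⇔-reflects ofʸ b  = of (mk⇔ (const b) (const a))
ofʸ a  ⇔-reflects ofⁿ ¬b = of (λ a⇔b → ¬b (to a⇔b a))
ofⁿ ¬a ⇔-reflects ofʸ b  = of (λ a⇔b → ¬a (from a⇔b b))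
ofⁿ ¬a ⇔-reflects ofⁿ ¬b = of (mk⇔ (λ a → contradiction a ¬a) (λ b → contradiction b ¬b))

anyUpToᵇ : (ℕ → Bool) → ℕ → Bool
anyUpToᵇ p zero    = false
anyUpToᵇ p (suc n) = p 0 ∨ anyUpToᵇ (p ∘ suc) n

T-anyUpToᵇ : ∀ p n → T (anyUpToᵇ p n) ⇔ ∃ λ k → k < n × T (p k)
T-anyUpToᵇ p n = mk⇔ (witness p n) (λ (k , k<n , pk) → intro p n k<n pk)
  where
  witness : ∀ p n → T (anyUpToᵇ p n) → ∃ λ k → k < n × T (p k)
  witness p (suc n) h with to (T-∨ {p 0}) h
  ... | inj₁ p0 = 0 , z<s , p0
  ... | inj₂ h′ with k , k<n , pk ← witness (p ∘ suc) n h′ = suc k , s<s k<n , pk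
  intro : ∀ p n {k} → k < n → T (p k) → T (anyUpToᵇ p n)
  intro p (suc n) {zero}  _         pk = from (T-∨ {p 0}) (inj₁ pk)
  intro p (suc n) {suc k} (s<s k<n) pk = from (T-∨ {p 0}) (inj₂ (intro (p ∘ suc) n k<n pk))

T-all-upTo : ∀ p n → T (all p (upTo n)) → ∀ {k} → k < n → T (p k)
T-all-upTo p n h k<n = All.lookup (all⁺ p (upTo n) h) (∈-upTo⁺ k<n)

<ᵇ-invariant : ∀ {f : ℕ → ℕ} → f Preserves _<_ ⟶ _<_ → ∀ a b → (f a <ᵇ f b) ≡ (a <ᵇ b)
<ᵇ-invariant {f} f-mono a b with a <ᵇ b | <ᵇ-reflects-< a b
... | true  | ofʸ a<b = det (<ᵇ-reflects-< (f a) (f b)) (ofʸ (f-mono a<b))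
... | false | ofⁿ a≮b = det (<ᵇ-reflects-< (f a) (f b)) (ofⁿ fa≮fb)
  where
  fa≮fb : f a ≮ f b
  fa≮fb fa<fb with m≤n⇒m<n∨m≡n (≮⇒≥ a≮b)
  ... | inj₁ b<a  = <-asym fa<fb (f-mono b<a)
  ... | inj₂ refl = <-irrefl refl fa<fb

bump-mono-< : ∀ x → bump x Preserves _<_ ⟶ _<_
bump-mono-< x {a} {b} a<b with a <ᵇ x | <ᵇ-reflects-< a x | b <ᵇ x | <ᵇ-reflects-< b x
... | true  | _       | true  | _       = a<b
... | true  | _       | false | _       = m<n⇒m<1+n a<b
... | false | _       | false | _       = s<s a<b
... | false | ofⁿ a≮x | true  | ofʸ b<x = contradiction (<-trans a<b b<x) a≮x

-- Order-isomorphism, decided by comparing each head with the entries after it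

SameComparison : ℕ → ℕ → ℕ → ℕ → Set
SameComparison x y x′ y′ = (x < x′ ⇔ y < y′) × (x′ < x ⇔ y′ < y)

sameComparisonᵇ : ℕ → ℕ → ℕ → ℕ → Bool
sameComparisonᵇ x y x′ y′ = ((x <ᵇ x′) ⇔ᵇ (y <ᵇ y′)) ∧ ((x′ <ᵇ x) ⇔ᵇ (y′ <ᵇ y))

sameComparison-reflects : ∀ x y x′ y′ → Reflects (SameComparison x y x′ y′) (sameComparisonᵇ x y x′ y′)
sameComparison-reflects x y x′ y′ =
  (<ᵇ-reflects-< x x′ ⇔-reflects <ᵇ-reflects-< y y′) ×-reflects (<ᵇ-reflects-< x′ x ⇔-reflects <ᵇ-reflects-< y′ y)

SameComparisons : ℕ → ℕ → (xs ys : List ℕ) → length xs ≡ length ys → Set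
SameComparisons x y xs ys e = ∀ j → SameComparison x y (lookup xs j) (lookup ys (cast e j))

sameComparisonsᵇ : ℕ → ℕ → List ℕ → List ℕ → Bool
sameComparisonsᵇ x y (x′ ∷ xs) (y′ ∷ ys) = sameComparisonᵇ x y x′ y′ ∧ sameComparisonsᵇ x y xs ys
sameComparisonsᵇ _ _ _         _         = true

orderIsoᵇ : List ℕ → List ℕ → Bool
orderIsoᵇ []       []       = true
orderIsoᵇ (x ∷ xs) (y ∷ ys) = sameComparisonsᵇ x y xs ys ∧ orderIsoᵇ xs ys
orderIsoᵇ _        _        = false

sameComparisonsᵇ-sound : ∀ x y xs ys → T (sameComparisonsᵇ x y xs ys) →
                         (e : length xs ≡ length ys) → SameComparisons x y xs ys e
sameComparisonsᵇ-sound x y (x′ ∷ xs) (y′ ∷ ys) h e fzero =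
  to (T⇔ (sameComparison-reflects x y x′ y′)) (proj₁ (to T-∧ h))
sameComparisonsᵇ-sound x y (x′ ∷ xs) (y′ ∷ ys) h e (fsuc j) =
  sameComparisonsᵇ-sound x y xs ys (proj₂ (to T-∧ h)) (suc-injective e) j

sameComparisonsᵇ-complete : ∀ x y xs ys (e : length xs ≡ length ys) →
                            SameComparisons x y xs ys e → T (sameComparisonsᵇ x y xs ys)
sameComparisonsᵇ-complete x y []        ys        e s = _
sameComparisonsᵇ-complete x y (x′ ∷ xs) (y′ ∷ ys) e s = from T-∧
  ( from (T⇔ (sameComparison-reflects x y x′ y′)) (s fzero)
  , sameComparisonsᵇ-complete x y xs ys (suc-injective e) (s ∘ fsuc))

orderIsoᵇ-sound : ∀ xs ys → T (orderIsoᵇ xs ys) → OrderIso xs ys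
orderIsoᵇ-sound []       []       _ = refl , λ ()
orderIsoᵇ-sound (x ∷ xs) (y ∷ ys) h = cong suc e , iso′
  where
  e : length xs ≡ length ys
  e = proj₁ (orderIsoᵇ-sound xs ys (proj₂ (to T-∧ h)))
  heads : SameComparisons x y xs ys e
  heads = sameComparisonsᵇ-sound x y xs ys (proj₁ (to T-∧ h)) e
  iso′ : ∀ i j → (lookup (x ∷ xs) i < lookup (x ∷ xs) j) ⇔
                 (lookup (y ∷ ys) (cast (cong suc e) i) < lookup (y ∷ ys) (cast (cong suc e) j))
  iso′ fzero    fzero    = mk⇔ (λ x<x → contradiction x<x (<-irrefl refl)) (λ y<y → contradiction y<y (<-irrefl refl))
  iso′ fzero    (fsuc j) = proj₁ (heads j)
  iso′ (fsuc i) fzero    = proj₂ (heads i)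
  iso′ (fsuc i) (fsuc j) = proj₂ (orderIsoᵇ-sound xs ys (proj₂ (to T-∧ h))) i j

orderIsoᵇ-complete : ∀ xs ys → OrderIso xs ys → T (orderIsoᵇ xs ys)
orderIsoᵇ-complete []       []       _        = _
orderIsoᵇ-complete (x ∷ xs) (y ∷ ys) (e , iso) = from T-∧
  ( sameComparisonsᵇ-complete x y xs ys e′ (λ j → iso fzero (fsuc j) , iso (fsuc j) fzero)
  , orderIsoᵇ-complete xs ys (e′ , λ i j → iso (fsuc i) (fsuc j)))
  where e′ = suc-injective e

orderIso-reflects : ∀ xs ys → Reflects (OrderIso xs ys) (orderIsoᵇ xs ys)
orderIso-reflects xs ys = fromEquivalence (orderIsoᵇ-sound xs ys) (orderIsoᵇ-complete xs ys)

module _ {f : ℕ → ℕ} (f-mono : f Preserves _<_ ⟶ _<_) where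

  sameComparisonsᵇ-map : ∀ x y xs ys →
    sameComparisonsᵇ (f x) (f y) (map f xs) (map f ys) ≡ sameComparisonsᵇ x y xs ys
  sameComparisonsᵇ-map x y []        ys        = refl
  sameComparisonsᵇ-map x y (x′ ∷ xs) []        = refl
  sameComparisonsᵇ-map x y (x′ ∷ xs) (y′ ∷ ys) =
    cong₂ _∧_ (cong₂ _∧_ (cong₂ _⇔ᵇ_ (inv x x′) (inv y y′)) (cong₂ _⇔ᵇ_ (inv x′ x) (inv y′ y)))
              (sameComparisonsᵇ-map x y xs ys)
    where inv = <ᵇ-invariant f-mono

  orderIsoᵇ-map : ∀ xs ys → orderIsoᵇ (map f xs) (map f ys) ≡ orderIsoᵇ xs ys
  orderIsoᵇ-map []       []       = refl
  orderIsoᵇ-map []       (_ ∷ _)  = refl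
  orderIsoᵇ-map (_ ∷ _)  []       = refl
  orderIsoᵇ-map (x ∷ xs) (y ∷ ys) = cong₂ _∧_ (sameComparisonsᵇ-map x y xs ys) (orderIsoᵇ-map xs ys)

  orderIso-map⁻ : ∀ xs ys → OrderIso (map f xs) (map f ys) → OrderIso xs ys
  orderIso-map⁻ xs ys iso =
    orderIsoᵇ-sound xs ys (subst T (orderIsoᵇ-map xs ys) (orderIsoᵇ-complete (map f xs) (map f ys) iso))

SquareAt : List ℕ → ℕ → ℕ → Set
SquareAt π i k = 2 ≤ k × i + 2 * k ≤ length π × OrderIso (factor π i k) (factor π (i + k) k)

-- The first argument stands for length π; it is passed in so that each scan below evaluates it only once.
squareAtᵇ : ℕ → List ℕ → ℕ → ℕ → Bool
squareAtᵇ n π i k = (2 ≤ᵇ k) ∧ (i + 2 * k ≤ᵇ n) ∧ orderIsoᵇ (factor π i k) (factor π (i + k) k)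

T-squareAtᵇ : ∀ π i k → T (squareAtᵇ (length π) π i k) ⇔ SquareAt π i k
T-squareAtᵇ π i k = T⇔ (≤ᵇ-reflects-≤ 2 k ×-reflects ≤ᵇ-reflects-≤ (i + 2 * k) (length π)
                         ×-reflects orderIso-reflects (factor π i k) (factor π (i + k) k))

squareAt-bounds : ∀ π i k → SquareAt π i k → i < length π × k < length π
squareAt-bounds π i k (2≤k , i+2k≤n , _) =
  <-≤-trans (m<m+n i 0<2k) i+2k≤n , <-≤-trans (m<m+n k 0<k) (m+n≤o⇒n≤o i i+2k≤n)
  where
  0<k : 0 < k + 0
  0<k = <-≤-trans z<s (≤-trans 2≤k (m≤m+n k 0))
  0<2k : 0 < 2 * k
  0<2k = <-≤-trans 0<k (m≤n+m (k + 0) k)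

PrefixSquare : List ℕ → Set
PrefixSquare π = ∃ (SquareAt π 0)

prefixSquareᵇ : List ℕ → Bool
prefixSquareᵇ π = scan (length π)
  where
  scan : ℕ → Bool
  scan n = anyUpToᵇ (squareAtᵇ n π 0) n

T-prefixSquareᵇ : ∀ π → T (prefixSquareᵇ π) ⇔ PrefixSquare π
T-prefixSquareᵇ π = mk⇔
  (λ h → let k , _ , sq = to (T-anyUpToᵇ _ (length π)) h in k , to (T-squareAtᵇ π 0 k) sq)
  (λ (k , sq) → from (T-anyUpToᵇ _ _) (k , proj₂ (squareAt-bounds π 0 k sq) , from (T-squareAtᵇ π 0 k) sq))

SuffixSquare : List ℕ → Set
SuffixSquare π = ∃₂ λ i k → SquareAt π i k × i + 2 * k ≡ length π

suffixSquareᵇ : List ℕ → Bool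
suffixSquareᵇ π = scan (length π)
  where
  scan : ℕ → Bool
  scan n = anyUpToᵇ (λ k → squareAtᵇ n π (n ∸ 2 * k) k) n

suffixSquareᵇ-complete : ∀ π → SuffixSquare π → T (suffixSquareᵇ π)
suffixSquareᵇ-complete π (i , k , sq , i+2k≡n) =
  from (T-anyUpToᵇ _ _)
       (k , proj₂ (squareAt-bounds π i k sq) ,
        from (T-squareAtᵇ π (length π ∸ 2 * k) k) (subst (λ j → SquareAt π j k) i≡n∸2k sq))
  where
  i≡n∸2k : i ≡ length π ∸ 2 * k
  i≡n∸2k = sym (subst (λ n → n ∸ 2 * k ≡ i) i+2k≡n (m+n∸n≡m i (2 * k)))

squareᵇ : List ℕ → Bool
squareᵇ π = scan (length π)
  where
  scan : ℕ → Bool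
  scan n = anyUpToᵇ (λ i → anyUpToᵇ (squareAtᵇ n π i) n) n

T-squareᵇ : ∀ π → T (squareᵇ π) ⇔ ContainsSquare π
T-squareᵇ π = mk⇔
  (λ h → let i , _ , h′ = to (T-anyUpToᵇ _ n) h ; k , _ , sq = to (T-anyUpToᵇ (squareAtᵇ n π i) n) h′ in
         i , k , to (T-squareAtᵇ π i k) sq)
  (λ (i , k , sq) → let i<n , k<n = squareAt-bounds π i k sq in
     from (T-anyUpToᵇ _ n) (i , i<n , from (T-anyUpToᵇ _ n) (k , k<n , from (T-squareAtᵇ π i k) sq)))
  where n = length π

square-∷ : ∀ a l → ContainsSquare (a ∷ l) → PrefixSquare (a ∷ l) ⊎ ContainsSquare l
square-∷ a l (zero  , sq)                     = inj₁ sq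
square-∷ a l (suc i , k , 2≤k , i+2k≤n , iso) = inj₂ (i , k , 2≤k , s≤s⁻¹ i+2k≤n , iso)

square-++ˡ : ∀ ys {l} → ContainsSquare l → ContainsSquare (ys ++ l)
square-++ˡ []       sq = sq
square-++ˡ (y ∷ ys) sq with i , k , 2≤k , i+2k≤n , iso ← square-++ˡ ys sq = suc i , k , 2≤k , s≤s i+2k≤n , iso

take-++ˡ : ∀ {A : Set} k (m r : List A) → k ≤ length m → take k (m ++ r) ≡ take k m
take-++ˡ zero    m       r _   = refl
take-++ˡ (suc k) (a ∷ m) r k≤n = cong (a ∷_) (take-++ˡ k m r (s≤s⁻¹ k≤n))

factor-++ˡ : ∀ i k (m r : List ℕ) → i + k ≤ length m → factor (m ++ r) i k ≡ factor m i k
factor-++ˡ zero    k m       r i+k≤n = take-++ˡ k m r i+k≤n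
factor-++ˡ (suc i) k (a ∷ m) r i+k≤n = factor-++ˡ i k m r (s≤s⁻¹ i+k≤n)

square-∷ʳ : ∀ m x → ContainsSquare (m ∷ʳ x) → ContainsSquare m ⊎ SuffixSquare (m ∷ʳ x)
square-∷ʳ m x (i , k , 2≤k , i+2k≤n+1 , iso) with i + 2 * k ≤? length m
... | yes i+2k≤n = inj₁ (i , k , 2≤k , i+2k≤n ,
                         subst₂ OrderIso (factor-++ˡ i k m [ x ] i+k≤n) (factor-++ˡ (i + k) k m [ x ] i+k+k≤n) iso)
  where
  i+k+k≤n : i + k + k ≤ length m
  i+k+k≤n = subst (_≤ length m) (trans (cong (i +_) (cong (k +_) (+-identityʳ k))) (sym (+-assoc i k k))) i+2k≤n
  i+k≤n : i + k ≤ length m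
  i+k≤n = ≤-trans (m≤m+n (i + k) k) i+k+k≤n
... | no i+2k≰n = inj₂ (i , k , (2≤k , i+2k≤n+1 , iso) ,
                        ≤-antisym i+2k≤n+1 (subst (_≤ i + 2 * k) (sym length-m∷ʳx) (≰⇒> i+2k≰n)))
  where
  length-m∷ʳx : length (m ∷ʳ x) ≡ suc (length m)
  length-m∷ʳx = trans (length-++ m) (+-comm (length m) 1)

square-map : ∀ {f} → f Preserves _<_ ⟶ _<_ → ∀ π → ContainsSquare (map f π) → ContainsSquare π
square-map {f} f-mono π (i , k , 2≤k , i+2k≤n , iso) =
  i , k , 2≤k , subst (i + 2 * k ≤_) (length-map f π) i+2k≤n ,
  orderIso-map⁻ f-mono (factor π i k) (factor π (i + k) k) (subst₂ OrderIso (factor-map i) (factor-map (i + k)) iso)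
  where
  factor-map : ∀ j → factor (map f π) j k ≡ map f (factor π j k)
  factor-map j = trans (cong (take k) (drop-map j π)) (take-map k (drop j π))

extend-right : ∀ π x → extend π x (length π) ≡ map (bump x) π ∷ʳ x
extend-right π x rewrite take-all (length π) π ≤-refl | drop-all (length π) π ≤-refl = refl

extend-left-squareFree : ∀ {π x} → SquareFree π → ¬ PrefixSquare (x ∷ map (bump x) π) → SquareFree (extend π x 0)
extend-left-squareFree {π} {x} sf no-prefix sq with square-∷ x (map (bump x) π) sq
... | inj₁ prefix = no-prefix prefix
... | inj₂ sq′    = sf (square-map (bump-mono-< x) π sq′)

extend-right-squareFree : ∀ {π x} → SquareFree π → ¬ SuffixSquare (map (bump x) π ∷ʳ x) →
                          SquareFree (extend π x (length π))
extend-right-squareFree {π} {x} sf no-suffix sq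
  with square-∷ʳ (map (bump x) π) x (subst ContainsSquare (extend-right π x) sq)
... | inj₁ sq′   = sf (square-map (bump-mono-< x) π sq′)
... | inj₂ suffix = no-suffix suffix

squareFreeExtensionᵇ : List ℕ → Bool
squareFreeExtensionᵇ π = anyUpToᵇ (λ k → leftᵇ (suc k) ∨ rightᵇ (suc k)) (suc (length π))
  where
  leftᵇ rightᵇ : ℕ → Bool
  leftᵇ  x = not (prefixSquareᵇ (x ∷ map (bump x) π))
  rightᵇ x = not (suffixSquareᵇ (map (bump x) π ∷ʳ x))

squareFreeExtensionᵇ-sound : ∀ π → T (squareFreeExtensionᵇ π) → ¬ Bicrucial π
squareFreeExtensionᵇ-sound π h (sf , left , right)
  with k , k≤n , hk ← to (T-anyUpToᵇ _ (suc (length π))) h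
  with to T-∨ hk
... | inj₁ no-prefix = extend-left-squareFree sf (T-not no-prefix ∘ from (T-prefixSquareᵇ _)) (left (suc k) (s≤s z≤n) k≤n)
... | inj₂ no-suffix = extend-right-squareFree sf (T-not no-suffix ∘ suffixSquareᵇ-complete _) (right (suc k) (s≤s z≤n) k≤n)

allPicksᵇ : ∀ {A : Set} → (A → List A → Bool) → List A → List A → Bool
allPicksᵇ p pre []         = true
allPicksᵇ p pre (a ∷ post) = p a (pre ++ post) ∧ allPicksᵇ p (pre ∷ʳ a) post

allPicksᵇ-sound : ∀ {A : Set} p pre (P : List A) {a} Q → T (allPicksᵇ p pre (P ++ [ a ] ++ Q)) → T (p a (pre ++ P ++ Q))
allPicksᵇ-sound p pre []      Q h = proj₁ (to T-∧ h)
allPicksᵇ-sound p pre (b ∷ P) Q h =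
  subst (T ∘ p _) (∷ʳ-++ pre b (P ++ Q)) (allPicksᵇ-sound p (pre ∷ʳ b) P Q (proj₂ (to (T-∧ {p b _}) h)))

-- The first argument bounds the recursion; it is the number of entries still to be placed.
refutesᵇ : ℕ → List ℕ → List ℕ → Bool
refutesᵇ _       []          l = squareFreeExtensionᵇ l
refutesᵇ zero    (_ ∷ _)     l = false
refutesᵇ (suc n) rem@(_ ∷ _) l = allPicksᵇ (λ a rest → prefixSquareᵇ (a ∷ l) ∨ refutesᵇ n rest (a ∷ l)) [] rem

refutesᵇ-sound : ∀ n rem l → T (refutesᵇ n rem l) → ∀ ys → ys ↭ rem → ¬ Bicrucial (ys ++ l)
refutesᵇ-sound n [] l h ys ys↭[] with refl ← ↭-empty-inv ys↭[] = squareFreeExtensionᵇ-sound l h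
refutesᵇ-sound (suc n) rem@(_ ∷ _) l h ys ys↭rem with initLast ys
... | []       = contradiction (↭-sym ys↭rem) ¬x∷xs↭[]
... | zs ∷ʳ′ a with P , Q , rem≡ ← ∈-∃++ (∈-resp-↭ ys↭rem (∈-++⁺ʳ zs (here refl)))
  with to T-∨ (allPicksᵇ-sound _ [] P Q (subst (T ∘ allPicksᵇ _ []) rem≡ h))
... | inj₁ prefix = λ (sf , _) →
  sf (subst ContainsSquare (sym (∷ʳ-++ zs a l)) (square-++ˡ zs (0 , to (T-prefixSquareᵇ (a ∷ l)) prefix)))
... | inj₂ deeper =
  refutesᵇ-sound n (P ++ Q) (a ∷ l) deeper zs zs↭P++Q ∘ subst Bicrucial (∷ʳ-++ zs a l)
  where
  zs↭P++Q : zs ↭ P ++ Q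
  zs↭P++Q = subst (_↭ P ++ Q) (++-identityʳ zs) (drop-mid zs P (subst (zs ∷ʳ a ↭_) rem≡ ys↭rem))

noBicrucialPermOfLength : ∀ n → T (refutesᵇ n (map suc (upTo n)) []) → ¬ BicrucialPermOfLength n
noBicrucialPermOfLength n h (π , π↭ , bic) =
  refutesᵇ-sound n _ [] h π π↭ (subst Bicrucial (sym (++-identityʳ π)) bic)

sort≡⇒IsPerm : ∀ n π → sort π ≡ map suc (upTo n) → IsPerm n π
sort≡⇒IsPerm n π eq = subst (π ↭_) eq (↭-sym (sort-↭ π))

extensionsSquareᵇ : List ℕ → ℕ → Bool
extensionsSquareᵇ π x = squareᵇ (extend π x 0) ∧ squareᵇ (extend π x (length π))

bicrucialᵇ : List ℕ → Bool
bicrucialᵇ π = not (squareᵇ π) ∧ all (extensionsSquareᵇ π ∘ suc) (upTo (suc (length π)))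

bicrucialᵇ-sound : ∀ π → T (bicrucialᵇ π) → Bicrucial π
bicrucialᵇ-sound π h =
  T-not square-free ∘ from (T-squareᵇ π) ,
  (λ { (suc k) _ k≤n → to (T-squareᵇ _) (proj₁ (extensions k≤n)) }) ,
  (λ { (suc k) _ k≤n → to (T-squareᵇ _) (proj₂ (extensions k≤n)) })
  where
  square-free = proj₁ (to (T-∧ {not (squareᵇ π)}) h)
  extensions : ∀ {k} → k < suc (length π) →
               T (squareᵇ (extend π (suc k) 0)) × T (squareᵇ (extend π (suc k) (length π)))
  extensions {k} k≤n = to (T-∧ {squareᵇ (extend π (suc k) 0)})
    (T-all-upTo (extensionsSquareᵇ π ∘ suc) (suc (length π)) (proj₂ (to (T-∧ {not (squareᵇ π)}) h)) k≤n)

bicrucialPermOfLength : ∀ n π → sort π ≡ map suc (upTo n) → T (bicrucialᵇ π) → BicrucialPermOfLength n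
bicrucialPermOfLength n π eq h = π , sort≡⇒IsPerm n π eq , bicrucialᵇ-sound π h

π₁₉ : List ℕ
π₁₉ = 19 ∷ 2 ∷ 7 ∷ 11 ∷ 5 ∷ 1 ∷ 4 ∷ 10 ∷ 8 ∷ 6 ∷ 17 ∷ 18 ∷ 12 ∷ 3 ∷ 9 ∷ 15 ∷ 14 ∷ 13 ∷ 16 ∷ []

π₂₇ : List ℕ
π₂₇ = 2 ∷ 6 ∷ 3 ∷ 1 ∷ 5 ∷ 26 ∷ 20 ∷ 15 ∷ 18 ∷ 24 ∷ 8 ∷ 7 ∷ 19 ∷ 27 ∷ 25 ∷ 13 ∷ 21 ∷ 22 ∷ 11 ∷ 9 ∷ 12 ∷ 23 ∷ 17 ∷ 10 ∷ 14 ∷ 16 ∷ 4 ∷ []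

theorem5 : ¬ BicrucialPermOfLength 11 × BicrucialPermOfLength 19 × BicrucialPermOfLength 27
theorem5 =
  noBicrucialPermOfLength 11 _ ,
  bicrucialPermOfLength 19 π₁₉ refl _ ,
  bicrucialPermOfLength 27 π₂₇ refl _
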